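{- Let $S$ be an atomic base, $A$ a formula, $\Gamma=x_1:A_1,\dots,x_n:A_n$ a context and $t$ a term with $tFV(t)\subseteq\{x_1,\dots,x_n\}$. If the term $t$ of $A$ from $\Gamma$ is I-valid, then $t\twoheadrightarrow s$ for some normal proof-term $s$ such that $\Gamma\vdash s:A$ is derivable in $\mathbf{IL_{at}}$.
   Context: $\mathbf{IL_{at}}$: formulas $A::=X\mid A\to B\mid\forall X.A$ ($X$ an atom); terms $t::=x\mid c^A\mid\lambda x.t\mid ts\mid\Lambda X.t\mid tX$ (a term-constant $c^A$ for every formula $A$; in $tX$, $X$ is an atom), up to $\alpha$-equivalence, capture-avoiding substitution; $tFV(t)$ = free term-variables; closed = no free term-variables. Typing rules: $\Gamma,x:A\vdash x:A$; $\Gamma\vdash c^A:A$ for every $A$; $\Gamma,x:A\vdash t:B\Rightarrow\Gamma\vdash\lambda x.t:A\to B$; $\Gamma\vdash t:A\to B,\ \Gamma\vdash s:A\Rightarrow\Gamma\vdash ts:B$; $\Gamma\vdash t:A\Rightarrow\Gamma\vdash\Lambda X.t:\forall X.A$ provided $X$ not free in formulas of $\Gamma$; $\Gamma\vdash t:\forall X.A\Rightarrow\Gamma\vdash tY:A[X:=Y]$ ($Y$ an atom). $\beta$-reduction: compatible closure of $(\lambda x.t)s\to_\beta t[x:=s]$, $(\Lambda X.t)Y\to_\beta t[X:=Y]$; $\twoheadrightarrow$ its reflexive-transitive closure; normal = contains no redex. An atomic base $S$ is a set of term-constants $c^X$ for atoms $X$. A proof-term is a term containing no term-constants other than those in $S$.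 qI-validity: (1) a closed term $t$ of atom $X$ is qI-valid iff $t\twoheadrightarrow s$ for a normal $s$ with $\vdash s:X$ derivable; (2) a closed $t$ of $B\to C$ is qI-valid iff $t\twoheadrightarrow\lambda x.u$ such that $u[x:=s]$ of $C$ is qI-valid for every qI-valid closed $s$ of $B$; (3) a closed $t$ of $\forall X.A$ is qI-valid iff $t\twoheadrightarrow\Lambda X.u$ such that $u[X:=Y]$ of $A[X:=Y]$ is qI-valid for every atom $Y$; (4) a term $t$ of $A$ from $x_1:A_1,\dots,x_n:A_n$ with $tFV(t)\subseteq\{x_1,\dots,x_n\}$ is qI-valid iff $t[x_1:=t_1,\dots,x_n:=t_n]$ of $A$ is qI-valid for all qI-valid closed $t_i$ of $A_i$. A term is I-valid iff it is a proof-term and qI-valid. -}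

module Defs where

open import Data.Nat using (ℕ; zero; suc; _<_; _⊔_)
open import Data.Fin using (Fin; toℕ)
open import Data.List using (List; []; _∷_; map; length; lookup)
open import Data.Product using (Σ; _×_; _,_)
open import Data.Empty using (⊥)
open import Relation.Nullary using (¬_)
open import Relation.Binary.Construct.Closure.ReflexiveTransitive using (Star)

-- Syntax of IL_at, de Bruijn style (α-equivalence classes are the
-- de Bruijn terms).  Atoms are natural numbers; inside k binders ∀/Λ,
-- index i < k denotes a bound atom and index k + Y the free atom Y.

infixr 7 _⇒_

data Form : Set where
  at  : ℕ → Form
  _⇒_ : Form → Form → Form
  ∀'  : Form → Form

data Tm : Set where
  var  : ℕ → Tm
  con  : Form → Tm
  lam  : Tm → Tm
  app  : Tm → Tm → Tm
  tlam : Tm → Tm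
  tapp : Tm → ℕ → Tm

-- Renaming of atoms (atom substitution X:=Y is a renaming)

ext : (ℕ → ℕ) → ℕ → ℕ
ext ρ zero    = zero
ext ρ (suc n) = suc (ρ n)

renF : (ℕ → ℕ) → Form → Form
renF ρ (at X)  = at (ρ X)
renF ρ (A ⇒ B) = renF ρ A ⇒ renF ρ B
renF ρ (∀' A)  = ∀' (renF (ext ρ) A)

-- the renaming realising [X:=Y] for the atom bound at index 0
inst : ℕ → ℕ → ℕ
inst Y zero    = Y
inst Y (suc n) = n

-- A[X:=Y] where ∀X.A is ∀' A
_[_]F : Form → ℕ → Form
A [ Y ]F = renF (inst Y) A

renTy : (ℕ → ℕ) → Tm → Tm
renTy ρ (var x)    = var x
renTy ρ (con A)    = con (renF ρ A)
renTy ρ (lam t)    = lam (renTy ρ t)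
renTy ρ (app t s)  = app (renTy ρ t) (renTy ρ s)
renTy ρ (tlam t)   = tlam (renTy (ext ρ) t)
renTy ρ (tapp t Y) = tapp (renTy ρ t) (ρ Y)

-- u[X:=Y] where ΛX.u is tlam u
_[_]T : Tm → ℕ → Tm
u [ Y ]T = renTy (inst Y) u

ren : (ℕ → ℕ) → Tm → Tm
ren ρ (var x)    = var (ρ x)
ren ρ (con A)    = con A
ren ρ (lam t)    = lam (ren (ext ρ) t)
ren ρ (app t s)  = app (ren ρ t) (ren ρ s)
ren ρ (tlam t)   = tlam (ren ρ t)
ren ρ (tapp t Y) = tapp (ren ρ t) Y

exts : (ℕ → Tm) → ℕ → Tm
exts σ zero    = var zero
exts σ (suc n) = ren suc (σ n)

sub : (ℕ → Tm) → Tm → Tm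
sub σ (var x)    = σ x
sub σ (con A)    = con A
sub σ (lam t)    = lam (sub (exts σ) t)
sub σ (app t s)  = app (sub σ t) (sub σ s)
sub σ (tlam t)   = tlam (sub (λ n → renTy suc (σ n)) t)
sub σ (tapp t Y) = tapp (sub σ t) Y

-- t[x:=s] where λx.t is lam t
single : Tm → ℕ → Tm
single s zero    = s
single s (suc n) = var n

_[_] : Tm → Tm → Tm
t [ s ] = sub (single s) t

-- Free term variables: FVBelow n t  iff  tFV(t) ⊆ {x_1,…,x_n}
-- (all free de Bruijn term indices are < n)

data FVBelow : ℕ → Tm → Set where
  var  : ∀ {n x} → x < n → FVBelow n (var x)
  con  : ∀ {n A} → FVBelow n (con A)
  lam  : ∀ {n t} → FVBelow (suc n) t → FVBelow n (lam t)
  app  : ∀ {n t s} → FVBelow n t → FVBelow n s → FVBelow n (app t s)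
  tlam : ∀ {n t} → FVBelow n t → FVBelow n (tlam t)
  tapp : ∀ {n t Y} → FVBelow n t → FVBelow n (tapp t Y)

Closed : Tm → Set
Closed = FVBelow zero

-- Typing (Curry style). Contexts: head of the list = variable index 0.

data _∋_∶_ : List Form → ℕ → Form → Set where
  here  : ∀ {Γ A} → (A ∷ Γ) ∋ zero ∶ A
  there : ∀ {Γ A B x} → Γ ∋ x ∶ A → (B ∷ Γ) ∋ suc x ∶ A

infix 4 _⊢_∶_

data _⊢_∶_ : List Form → Tm → Form → Set where
  var  : ∀ {Γ x A} → Γ ∋ x ∶ A → Γ ⊢ var x ∶ A
  con  : ∀ {Γ A} → Γ ⊢ con A ∶ A
  lam  : ∀ {Γ t A B} → (A ∷ Γ) ⊢ t ∶ B → Γ ⊢ lam t ∶ A ⇒ B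
  app  : ∀ {Γ t s A B} → Γ ⊢ t ∶ A ⇒ B → Γ ⊢ s ∶ A → Γ ⊢ app t s ∶ B
  -- side condition "X not free in Γ": Γ is weakened past the new binder
  tlam : ∀ {Γ t A} → map (renF suc) Γ ⊢ t ∶ A → Γ ⊢ tlam t ∶ ∀' A
  tapp : ∀ {Γ t A} Y → Γ ⊢ t ∶ ∀' A → Γ ⊢ tapp t Y ∶ A [ Y ]F

infix 4 _⟶_ _↠_

data _⟶_ : Tm → Tm → Set where
  β     : ∀ {t s} → app (lam t) s ⟶ t [ s ]
  βT    : ∀ {t Y} → tapp (tlam t) Y ⟶ t [ Y ]T
  ξlam  : ∀ {t t'} → t ⟶ t' → lam t ⟶ lam t'
  ξappl : ∀ {t t' s} → t ⟶ t' → app t s ⟶ app t' s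
  ξappr : ∀ {t s s'} → s ⟶ s' → app t s ⟶ app t s'
  ξtlam : ∀ {t t'} → t ⟶ t' → tlam t ⟶ tlam t'
  ξtapp : ∀ {t t' Y} → t ⟶ t' → tapp t Y ⟶ tapp t' Y

_↠_ : Tm → Tm → Set
_↠_ = Star _⟶_

data HasRedex : Tm → Set where
  rβ    : ∀ {t s} → HasRedex (app (lam t) s)
  rβT   : ∀ {t Y} → HasRedex (tapp (tlam t) Y)
  inlam  : ∀ {t} → HasRedex t → HasRedex (lam t)
  inappl : ∀ {t s} → HasRedex t → HasRedex (app t s)
  inappr : ∀ {t s} → HasRedex s → HasRedex (app t s)
  intlam : ∀ {t} → HasRedex t → HasRedex (tlam t)
  intapp : ∀ {t Y} → HasRedex t → HasRedex (tapp t Y)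

Normal : Tm → Set
Normal t = ¬ HasRedex t

-- An atomic base S is given by the set of atoms X with c^X ∈ S.
-- ProofTerm S t: every constant occurring in t is some c^X ∈ S,
-- X a free atom (under a Λ the atom indices are shifted, and the
-- freshly bound atom is not a member).

AtomicBase : Set₁
AtomicBase = ℕ → Set

liftS : AtomicBase → AtomicBase
liftS S zero    = ⊥
liftS S (suc n) = S n

data ProofTerm : AtomicBase → Tm → Set₁ where
  var  : ∀ {S x} → ProofTerm S (var x)
  con  : ∀ {S X} → S X → ProofTerm S (con (at X))
  lam  : ∀ {S t} → ProofTerm S t → ProofTerm S (lam t)
  app  : ∀ {S t s} → ProofTerm S t → ProofTerm S s → ProofTerm S (app t s)
  tlam : ∀ {S t} → ProofTerm (liftS S) t → ProofTerm S (tlam t)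
  tapp : ∀ {S t Y} → ProofTerm S t → ProofTerm S (tapp t Y)

-- qI-validity of closed terms.  Defined by recursion on a fuel n;
-- the fuel 'depth A' is always sufficient since depth is invariant
-- under atom renaming (A[X:=Y] has the same depth as A).

depth : Form → ℕ
depth (at X)  = zero
depth (A ⇒ B) = suc (depth A ⊔ depth B)
depth (∀' A)  = suc (depth A)

qIV : ℕ → Form → Tm → Set
qIV n       (at X)  t = Σ Tm λ s → (t ↠ s) × Normal s × ([] ⊢ s ∶ at X)
qIV zero    (B ⇒ C) t = ⊥
qIV (suc n) (B ⇒ C) t =
  Σ Tm λ u → (t ↠ lam u) ×
    ((s : Tm) → Closed s → qIV n B s → qIV n C (u [ s ]))
qIV zero    (∀' A)  t = ⊥
qIV (suc n) (∀' A)  t =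
  Σ Tm λ u → (t ↠ tlam u) × ((Y : ℕ) → qIV n (A [ Y ]F) (u [ Y ]T))

qIValidClosed : Form → Tm → Set
qIValidClosed A t = qIV (depth A) A t

-- clause (4): term t of A from Γ is qI-valid
-- (σ maps variable index i to the closed term substituted for it)
qIValid : List Form → Tm → Form → Set
qIValid Γ t A =
  (σ : ℕ → Tm) →
  ((i : Fin (length Γ)) →
     Closed (σ (toℕ i)) × qIValidClosed (lookup Γ i) (σ (toℕ i))) →
  qIValidClosed A (sub σ t)

IValid : AtomicBase → List Form → Tm → Form → Set₁
IValid S Γ t A = ProofTerm S t × qIValid Γ t A

{-# OPTIONS --safe #-}
-- For x : B in Γ substitute the stand-in η B c^B, the η-expansion of the constant c^B.
-- Stand-ins are qI-valid: by induction on the formula, η-expansions of neutral normal terms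
-- are valid, simultaneously with the fact that valid closed terms reduce to typed normal
-- forms (at ∀X.A one instantiates X by a fresh atom and renames it back). So the closed
-- instance of t has a typed normal form. Every reduction of that instance is mirrored by a
-- reduction of t itself: the only redexes of the instance that t lacks are η-expanded
-- stand-ins applied to an argument, and contracting one gives back the unexpanded
-- application, which needs no step of t. Normality and typing then transfer from the
-- normal form of the instance to the corresponding reduct of t.
module Submission where

open import Defs
open import Data.List using (List; []; _∷_; map; _++_; length; lookup)
open import Data.List.Properties using (map-∘; map-cong; map-id; map-++; length-map)
open import Data.Product using (Σ; ∃; _×_; _,_)
open import Data.Nat using (ℕ; zero; suc; _+_; _<_; _≤_; z≤n; s≤s; _⊔_; pred; _≟_)
open import Data.Nat.Properties using (m≤m⊔n; m≤n⊔m; ≤-trans; ≤-refl; <⇒≢; m≤n⇒m≤1+n)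
open import Data.Fin using (Fin; toℕ)
open import Data.Empty using (⊥-elim)
open import Function using (id; _∘_)
open import Relation.Nullary using (yes; no)
open import Relation.Binary.PropositionalEquality hiding ([_])
open import Relation.Binary.Construct.Closure.ReflexiveTransitive using (ε; _◅_; _◅◅_; gmap)

variable
  f g h f′ g′ ρ : ℕ → ℕ
  σ τ : ℕ → Tm
  A B C : Form
  Γ Δ Θ : List Form
  t t′ s s′ u a a′ b b′ c : Tm
  ℓ ℓ′ x y i Y : ℕ

ext-id : f ≗ id → ext f ≗ id
ext-id f≗id zero    = refl
ext-id f≗id (suc x) = cong suc (f≗id x)

ext-∘ : f ∘ g ≗ h → ext f ∘ ext g ≗ ext h
ext-∘ fg≗h zero    = refl
ext-∘ fg≗h (suc x) = cong suc (fg≗h x)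

renF-id : f ≗ id → renF f ≗ id
renF-id f≗id (at X)  = cong at (f≗id X)
renF-id f≗id (A ⇒ B) = cong₂ _⇒_ (renF-id f≗id A) (renF-id f≗id B)
renF-id f≗id (∀' A)  = cong ∀' (renF-id (ext-id f≗id) A)

renF-∘ : f ∘ g ≗ h → renF f ∘ renF g ≗ renF h
renF-∘ fg≗h (at X)  = cong at (fg≗h X)
renF-∘ fg≗h (A ⇒ B) = cong₂ _⇒_ (renF-∘ fg≗h A) (renF-∘ fg≗h B)
renF-∘ fg≗h (∀' A)  = cong ∀' (renF-∘ (ext-∘ fg≗h) A)

renF-inverse : f ∘ g ≗ id → renF f ∘ renF g ≗ id
renF-inverse fg≗id A = trans (renF-∘ fg≗id A) (renF-id (λ _ → refl) A)

renF-square : f ∘ g ≗ f′ ∘ g′ → renF f ∘ renF g ≗ renF f′ ∘ renF g′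
renF-square sq A = trans (renF-∘ sq A) (sym (renF-∘ (λ _ → refl) A))

renTy-id : f ≗ id → renTy f ≗ id
renTy-id f≗id (var x)    = refl
renTy-id f≗id (con A)    = cong con (renF-id f≗id A)
renTy-id f≗id (lam t)    = cong lam (renTy-id f≗id t)
renTy-id f≗id (app t s)  = cong₂ app (renTy-id f≗id t) (renTy-id f≗id s)
renTy-id f≗id (tlam t)   = cong tlam (renTy-id (ext-id f≗id) t)
renTy-id f≗id (tapp t Y) = cong₂ tapp (renTy-id f≗id t) (f≗id Y)

renTy-∘ : f ∘ g ≗ h → renTy f ∘ renTy g ≗ renTy h
renTy-∘ fg≗h (var x)    = refl
renTy-∘ fg≗h (con A)    = cong con (renF-∘ fg≗h A)
renTy-∘ fg≗h (lam t)    = cong lam (renTy-∘ fg≗h t)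
renTy-∘ fg≗h (app t s)  = cong₂ app (renTy-∘ fg≗h t) (renTy-∘ fg≗h s)
renTy-∘ fg≗h (tlam t)   = cong tlam (renTy-∘ (ext-∘ fg≗h) t)
renTy-∘ fg≗h (tapp t Y) = cong₂ tapp (renTy-∘ fg≗h t) (fg≗h Y)

renTy-inverse : f ∘ g ≗ id → renTy f ∘ renTy g ≗ id
renTy-inverse fg≗id t = trans (renTy-∘ fg≗id t) (renTy-id (λ _ → refl) t)

renTy-square : f ∘ g ≗ f′ ∘ g′ → renTy f ∘ renTy g ≗ renTy f′ ∘ renTy g′
renTy-square sq t = trans (renTy-∘ sq t) (sym (renTy-∘ (λ _ → refl) t))

inst-ext : ∀ f Y → inst (f Y) ∘ ext f ≗ f ∘ inst Y
inst-ext f Y zero    = refl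
inst-ext f Y (suc x) = refl

renF-[]F : ∀ f A Y → renF f (A [ Y ]F) ≡ renF (ext f) A [ f Y ]F
renF-[]F f A Y = sym (renF-square (inst-ext f Y) A)

renTy-[]T : ∀ f t Y → renTy f (t [ Y ]T) ≡ renTy (ext f) t [ f Y ]T
renTy-[]T f t Y = sym (renTy-square (inst-ext f Y) t)

weaken-[]T : ∀ t Y → renTy suc t [ Y ]T ≡ t
weaken-[]T t Y = renTy-inverse (λ _ → refl) t

map-weaken-ext : ∀ f Θ → map (renF (ext f)) (map (renF suc) Θ) ≡ map (renF suc) (map (renF f) Θ)
map-weaken-ext f Θ = trans (sym (map-∘ Θ)) (trans (map-cong (renF-square (λ _ → refl)) Θ) (map-∘ Θ))

map-weaken-inst : ∀ Y Θ → map (renF (inst Y)) (map (renF suc) Θ) ≡ Θ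
map-weaken-inst Y Θ = trans (sym (map-∘ Θ)) (trans (map-cong (renF-inverse (λ _ → refl)) Θ) (map-id Θ))

depth-renF : ∀ f A → depth (renF f A) ≡ depth A
depth-renF f (at X)  = refl
depth-renF f (A ⇒ B) = cong₂ (λ m n → suc (m ⊔ n)) (depth-renF f A) (depth-renF f B)
depth-renF f (∀' A)  = cong suc (depth-renF (ext f) A)

ren-∘ : f ∘ g ≗ h → ren f ∘ ren g ≗ ren h
ren-∘ fg≗h (var x)    = cong var (fg≗h x)
ren-∘ fg≗h (con A)    = refl
ren-∘ fg≗h (lam t)    = cong lam (ren-∘ (ext-∘ fg≗h) t)
ren-∘ fg≗h (app t s)  = cong₂ app (ren-∘ fg≗h t) (ren-∘ fg≗h s)
ren-∘ fg≗h (tlam t)   = cong tlam (ren-∘ fg≗h t)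
ren-∘ fg≗h (tapp t Y) = cong (λ t → tapp t Y) (ren-∘ fg≗h t)

ren-square : f ∘ g ≗ f′ ∘ g′ → ren f ∘ ren g ≗ ren f′ ∘ ren g′
ren-square sq t = trans (ren-∘ sq t) (sym (ren-∘ (λ _ → refl) t))

ren-renTy : ∀ ρ f → ren ρ ∘ renTy f ≗ renTy f ∘ ren ρ
ren-renTy ρ f (var x)    = refl
ren-renTy ρ f (con A)    = refl
ren-renTy ρ f (lam t)    = cong lam (ren-renTy (ext ρ) f t)
ren-renTy ρ f (app t s)  = cong₂ app (ren-renTy ρ f t) (ren-renTy ρ f s)
ren-renTy ρ f (tlam t)   = cong tlam (ren-renTy ρ (ext f) t)
ren-renTy ρ f (tapp t Y) = cong (λ t → tapp t (f Y)) (ren-renTy ρ f t)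

exts-cong : σ ≗ τ → exts σ ≗ exts τ
exts-cong σ≗τ zero    = refl
exts-cong σ≗τ (suc x) = cong (ren suc) (σ≗τ x)

sub-cong : σ ≗ τ → sub σ ≗ sub τ
sub-cong σ≗τ (var x)    = σ≗τ x
sub-cong σ≗τ (con A)    = refl
sub-cong σ≗τ (lam t)    = cong lam (sub-cong (exts-cong σ≗τ) t)
sub-cong σ≗τ (app t s)  = cong₂ app (sub-cong σ≗τ t) (sub-cong σ≗τ s)
sub-cong σ≗τ (tlam t)   = cong tlam (sub-cong (cong (renTy suc) ∘ σ≗τ) t)
sub-cong σ≗τ (tapp t Y) = cong (λ t → tapp t Y) (sub-cong σ≗τ t)

sub-id : σ ≗ var → sub σ ≗ id
sub-id σ≗var (var x)    = σ≗var x
sub-id σ≗var (con A)    = refl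
sub-id σ≗var (lam t)    = cong lam (sub-id (exts-var σ≗var) t)
  where
  exts-var : σ ≗ var → exts σ ≗ var
  exts-var σ≗var zero    = refl
  exts-var σ≗var (suc x) = cong (ren suc) (σ≗var x)
sub-id σ≗var (app t s)  = cong₂ app (sub-id σ≗var t) (sub-id σ≗var s)
sub-id σ≗var (tlam t)   = cong tlam (sub-id (cong (renTy suc) ∘ σ≗var) t)
sub-id σ≗var (tapp t Y) = cong (λ t → tapp t Y) (sub-id σ≗var t)

sub-ren : ∀ σ ρ → sub σ ∘ ren ρ ≗ sub (σ ∘ ρ)
sub-ren σ ρ (var x)    = refl
sub-ren σ ρ (con A)    = refl
sub-ren σ ρ (lam t)    = cong lam (trans (sub-ren (exts σ) (ext ρ) t) (sub-cong exts-ext t))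
  where
  exts-ext : exts σ ∘ ext ρ ≗ exts (σ ∘ ρ)
  exts-ext zero    = refl
  exts-ext (suc x) = refl
sub-ren σ ρ (app t s)  = cong₂ app (sub-ren σ ρ t) (sub-ren σ ρ s)
sub-ren σ ρ (tlam t)   = cong tlam (sub-ren (renTy suc ∘ σ) ρ t)
sub-ren σ ρ (tapp t Y) = cong (λ t → tapp t Y) (sub-ren σ ρ t)

ren-sub : ∀ ρ σ → ren ρ ∘ sub σ ≗ sub (ren ρ ∘ σ)
ren-sub ρ σ (var x)    = refl
ren-sub ρ σ (con A)    = refl
ren-sub ρ σ (lam t)    = cong lam (trans (ren-sub (ext ρ) (exts σ) t) (sub-cong ext-exts t))
  where
  ext-exts : ren (ext ρ) ∘ exts σ ≗ exts (ren ρ ∘ σ)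
  ext-exts zero    = refl
  ext-exts (suc x) = ren-square (λ _ → refl) (σ x)
ren-sub ρ σ (app t s)  = cong₂ app (ren-sub ρ σ t) (ren-sub ρ σ s)
ren-sub ρ σ (tlam t)   =
  cong tlam (trans (ren-sub ρ (renTy suc ∘ σ) t) (sub-cong (ren-renTy ρ suc ∘ σ) t))
ren-sub ρ σ (tapp t Y) = cong (λ t → tapp t Y) (ren-sub ρ σ t)

renTy-sub : ∀ f σ → renTy f ∘ sub σ ≗ sub (renTy f ∘ σ) ∘ renTy f
renTy-sub f σ (var x)    = refl
renTy-sub f σ (con A)    = refl
renTy-sub f σ (lam t)    =
  cong lam (trans (renTy-sub f (exts σ) t) (sub-cong renTy-exts (renTy f t)))
  where
  renTy-exts : renTy f ∘ exts σ ≗ exts (renTy f ∘ σ)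
  renTy-exts zero    = refl
  renTy-exts (suc x) = sym (ren-renTy suc f (σ x))
renTy-sub f σ (app t s)  = cong₂ app (renTy-sub f σ t) (renTy-sub f σ s)
renTy-sub f σ (tlam t)   =
  cong tlam (trans (renTy-sub (ext f) (renTy suc ∘ σ) t)
                   (sub-cong (renTy-square (λ _ → refl) ∘ σ) (renTy (ext f) t)))
renTy-sub f σ (tapp t Y) = cong (λ t → tapp t (f Y)) (renTy-sub f σ t)

sub-exts-weaken : ∀ σ t → sub (exts σ) (ren suc t) ≡ ren suc (sub σ t)
sub-exts-weaken σ t = trans (sub-ren (exts σ) suc t) (sym (ren-sub suc σ t))

sub-tlam-weaken : ∀ σ t → sub (renTy suc ∘ σ) (renTy suc t) ≡ renTy suc (sub σ t)
sub-tlam-weaken σ t = sym (renTy-sub suc σ t)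

weaken-[] : ∀ t s → ren suc t [ s ] ≡ t
weaken-[] t s = trans (sub-ren (single s) suc t) (sub-id (λ _ → refl) t)

ren-[] : ∀ ρ t s → ren ρ (t [ s ]) ≡ ren (ext ρ) t [ ren ρ s ]
ren-[] ρ t s =
  trans (ren-sub ρ (single s) t)
        (trans (sub-cong single-ext t) (sym (sub-ren (single (ren ρ s)) (ext ρ) t)))
  where
  single-ext : ren ρ ∘ single s ≗ single (ren ρ s) ∘ ext ρ
  single-ext zero    = refl
  single-ext (suc x) = refl

renTy-[] : ∀ f t s → renTy f (t [ s ]) ≡ renTy f t [ renTy f s ]
renTy-[] f t s = trans (renTy-sub f (single s) t) (sub-cong renTy-single (renTy f t))
  where
  renTy-single : renTy f ∘ single s ≗ single (renTy f s)
  renTy-single zero    = refl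
  renTy-single (suc x) = refl

lam-↠ : t ↠ t′ → lam t ↠ lam t′
lam-↠ = gmap lam ξlam

tlam-↠ : t ↠ t′ → tlam t ↠ tlam t′
tlam-↠ = gmap tlam ξtlam

appˡ-↠ : t ↠ t′ → app t s ↠ app t′ s
appˡ-↠ {s = s} = gmap (λ t → app t s) ξappl

appʳ-↠ : s ↠ s′ → app t s ↠ app t s′
appʳ-↠ {t = t} = gmap (app t) ξappr

app-↠ : t ↠ t′ → s ↠ s′ → app t s ↠ app t′ s′
app-↠ t↠t′ s↠s′ = appˡ-↠ t↠t′ ◅◅ appʳ-↠ s↠s′

tapp-↠ : t ↠ t′ → tapp t Y ↠ tapp t′ Y
tapp-↠ {Y = Y} = gmap (λ t → tapp t Y) ξtapp

renTy-⟶ : ∀ f → t ⟶ t′ → renTy f t ⟶ renTy f t′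
renTy-⟶ f (β {t} {s})  = subst (renTy f (app (lam t) s) ⟶_) (sym (renTy-[] f t s)) β
renTy-⟶ f (βT {t} {Y}) = subst (renTy f (tapp (tlam t) Y) ⟶_) (sym (renTy-[]T f t Y)) βT
renTy-⟶ f (ξlam r)     = ξlam (renTy-⟶ f r)
renTy-⟶ f (ξappl r)    = ξappl (renTy-⟶ f r)
renTy-⟶ f (ξappr r)    = ξappr (renTy-⟶ f r)
renTy-⟶ f (ξtlam r)    = ξtlam (renTy-⟶ (ext f) r)
renTy-⟶ f (ξtapp r)    = ξtapp (renTy-⟶ f r)

renTy-↠ : ∀ f → t ↠ t′ → renTy f t ↠ renTy f t′
renTy-↠ f = gmap (renTy f) (renTy-⟶ f)

ren-⟶⁻ : ∀ ρ t → ren ρ t ⟶ u → ∃ λ t′ → (t ⟶ t′) × (u ≡ ren ρ t′)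
ren-⟶⁻ ρ (lam t) (ξlam r) with ren-⟶⁻ (ext ρ) t r
... | t′ , r′ , refl = lam t′ , ξlam r′ , refl
ren-⟶⁻ ρ (app (lam t) s) β = t [ s ] , β , sym (ren-[] ρ t s)
ren-⟶⁻ ρ (app t s) (ξappl r) with ren-⟶⁻ ρ t r
... | t′ , r′ , refl = app t′ s , ξappl r′ , refl
ren-⟶⁻ ρ (app t s) (ξappr r) with ren-⟶⁻ ρ s r
... | s′ , r′ , refl = app t s′ , ξappr r′ , refl
ren-⟶⁻ ρ (tlam t) (ξtlam r) with ren-⟶⁻ ρ t r
... | t′ , r′ , refl = tlam t′ , ξtlam r′ , refl
ren-⟶⁻ ρ (tapp (tlam t) Y) βT = t [ Y ]T , βT , sym (ren-renTy ρ (inst Y) t)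
ren-⟶⁻ ρ (tapp t Y) (ξtapp r) with ren-⟶⁻ ρ t r
... | t′ , r′ , refl = tapp t′ Y , ξtapp r′ , refl

ren-↠⁻ : ∀ ρ t → ren ρ t ↠ u → ∃ λ t′ → (t ↠ t′) × (u ≡ ren ρ t′)
ren-↠⁻ ρ t ε = t , ε , refl
ren-↠⁻ ρ t (r ◅ q) with ren-⟶⁻ ρ t r
... | t₁ , r₁ , refl with ren-↠⁻ ρ t₁ q
... | t′ , q′ , refl = t′ , r₁ ◅ q′ , refl

renTy-⟶⁻ : ∀ f t → renTy f t ⟶ u → ∃ λ t′ → (t ⟶ t′) × (u ≡ renTy f t′)
renTy-⟶⁻ f (lam t) (ξlam r) with renTy-⟶⁻ f t r
... | t′ , r′ , refl = lam t′ , ξlam r′ , refl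
renTy-⟶⁻ f (app (lam t) s) β = t [ s ] , β , sym (renTy-[] f t s)
renTy-⟶⁻ f (app t s) (ξappl r) with renTy-⟶⁻ f t r
... | t′ , r′ , refl = app t′ s , ξappl r′ , refl
renTy-⟶⁻ f (app t s) (ξappr r) with renTy-⟶⁻ f s r
... | s′ , r′ , refl = app t s′ , ξappr r′ , refl
renTy-⟶⁻ f (tlam t) (ξtlam r) with renTy-⟶⁻ (ext f) t r
... | t′ , r′ , refl = tlam t′ , ξtlam r′ , refl
renTy-⟶⁻ f (tapp (tlam t) Y) βT = t [ Y ]T , βT , sym (renTy-[]T f t Y)
renTy-⟶⁻ f (tapp t Y) (ξtapp r) with renTy-⟶⁻ f t r
... | t′ , r′ , refl = tapp t′ Y , ξtapp r′ , refl

renTy-↠⁻ : ∀ f t → renTy f t ↠ u → ∃ λ t′ → (t ↠ t′) × (u ≡ renTy f t′)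
renTy-↠⁻ f t ε = t , ε , refl
renTy-↠⁻ f t (r ◅ q) with renTy-⟶⁻ f t r
... | t₁ , r₁ , refl with renTy-↠⁻ f t₁ q
... | t′ , q′ , refl = t′ , r₁ ◅ q′ , refl

ren-HasRedex : ∀ ρ → HasRedex t → HasRedex (ren ρ t)
ren-HasRedex ρ rβ         = rβ
ren-HasRedex ρ rβT        = rβT
ren-HasRedex ρ (inlam r)  = inlam (ren-HasRedex (ext ρ) r)
ren-HasRedex ρ (inappl r) = inappl (ren-HasRedex ρ r)
ren-HasRedex ρ (inappr r) = inappr (ren-HasRedex ρ r)
ren-HasRedex ρ (intlam r) = intlam (ren-HasRedex ρ r)
ren-HasRedex ρ (intapp r) = intapp (ren-HasRedex ρ r)

renTy-HasRedex : ∀ f → HasRedex t → HasRedex (renTy f t)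
renTy-HasRedex f rβ         = rβ
renTy-HasRedex f rβT        = rβT
renTy-HasRedex f (inlam r)  = inlam (renTy-HasRedex f r)
renTy-HasRedex f (inappl r) = inappl (renTy-HasRedex f r)
renTy-HasRedex f (inappr r) = inappr (renTy-HasRedex f r)
renTy-HasRedex f (intlam r) = intlam (renTy-HasRedex (ext f) r)
renTy-HasRedex f (intapp r) = intapp (renTy-HasRedex f r)

renTy-HasRedex⁻ : ∀ f t → HasRedex (renTy f t) → HasRedex t
renTy-HasRedex⁻ f (lam t)           (inlam r)  = inlam (renTy-HasRedex⁻ f t r)
renTy-HasRedex⁻ f (app (lam t) s)   rβ         = rβ
renTy-HasRedex⁻ f (app t s)         (inappl r) = inappl (renTy-HasRedex⁻ f t r)
renTy-HasRedex⁻ f (app t s)         (inappr r) = inappr (renTy-HasRedex⁻ f s r)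
renTy-HasRedex⁻ f (tlam t)          (intlam r) = intlam (renTy-HasRedex⁻ (ext f) t r)
renTy-HasRedex⁻ f (tapp (tlam t) Y) rβT        = rβT
renTy-HasRedex⁻ f (tapp t Y)        (intapp r) = intapp (renTy-HasRedex⁻ f t r)

ext-< : ∀ {m k} → (∀ x → x < m → ρ x < k) → ∀ x → x < suc m → ext ρ x < suc k
ext-< ρ< zero    _         = s≤s z≤n
ext-< ρ< (suc x) (s≤s x<m) = s≤s (ρ< x x<m)

FVBelow-ren : ∀ {m k} → (∀ x → x < m → ρ x < k) → FVBelow m t → FVBelow k (ren ρ t)
FVBelow-ren ρ< (var x<m)    = var (ρ< _ x<m)
FVBelow-ren ρ< con          = con
FVBelow-ren ρ< (lam fv)     = lam (FVBelow-ren (ext-< ρ<) fv)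
FVBelow-ren ρ< (app fv fv′) = app (FVBelow-ren ρ< fv) (FVBelow-ren ρ< fv′)
FVBelow-ren ρ< (tlam fv)    = tlam (FVBelow-ren ρ< fv)
FVBelow-ren ρ< (tapp fv)    = tapp (FVBelow-ren ρ< fv)

FVBelow-weaken : ∀ {m} → FVBelow m t → FVBelow (suc m) (ren suc t)
FVBelow-weaken = FVBelow-ren (λ _ → s≤s)

FVBelow-renTy : ∀ {m} f → FVBelow m t → FVBelow m (renTy f t)
FVBelow-renTy f (var x<m)    = var x<m
FVBelow-renTy f con          = con
FVBelow-renTy f (lam fv)     = lam (FVBelow-renTy f fv)
FVBelow-renTy f (app fv fv′) = app (FVBelow-renTy f fv) (FVBelow-renTy f fv′)
FVBelow-renTy f (tlam fv)    = tlam (FVBelow-renTy (ext f) fv)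
FVBelow-renTy f (tapp fv)    = tapp (FVBelow-renTy f fv)

FVBelow-sub : ∀ {m k} → (∀ x → x < m → FVBelow k (σ x)) → FVBelow m t → FVBelow k (sub σ t)
FVBelow-sub σ< (var x<m)    = σ< _ x<m
FVBelow-sub σ< con          = con
FVBelow-sub σ< (lam fv)     = lam (FVBelow-sub exts< fv)
  where
  exts< : ∀ x → x < suc _ → FVBelow (suc _) (exts _ x)
  exts< zero    _         = var (s≤s z≤n)
  exts< (suc x) (s≤s x<m) = FVBelow-weaken (σ< x x<m)
FVBelow-sub σ< (app fv fv′) = app (FVBelow-sub σ< fv) (FVBelow-sub σ< fv′)
FVBelow-sub σ< (tlam fv)    = tlam (FVBelow-sub (λ x x<m → FVBelow-renTy suc (σ< x x<m)) fv)
FVBelow-sub σ< (tapp fv)    = tapp (FVBelow-sub σ< fv)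

FVBelow-[] : ∀ {m} → FVBelow (suc m) t → FVBelow m s → FVBelow m (t [ s ])
FVBelow-[] fv fv′ = FVBelow-sub single< fv
  where
  single< : ∀ x → x < suc _ → FVBelow _ (single _ x)
  single< zero    _         = fv′
  single< (suc x) (s≤s x<m) = var x<m

FVBelow-⟶ : ∀ {m} → t ⟶ t′ → FVBelow m t → FVBelow m t′
FVBelow-⟶ β         (app (lam fv) fv′) = FVBelow-[] fv fv′
FVBelow-⟶ βT        (tapp (tlam fv))   = FVBelow-renTy _ fv
FVBelow-⟶ (ξlam r)  (lam fv)           = lam (FVBelow-⟶ r fv)
FVBelow-⟶ (ξappl r) (app fv fv′)       = app (FVBelow-⟶ r fv) fv′
FVBelow-⟶ (ξappr r) (app fv fv′)       = app fv (FVBelow-⟶ r fv′)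
FVBelow-⟶ (ξtlam r) (tlam fv)          = tlam (FVBelow-⟶ r fv)
FVBelow-⟶ (ξtapp r) (tapp fv)          = tapp (FVBelow-⟶ r fv)

FVBelow-↠ : ∀ {m} → t ↠ t′ → FVBelow m t → FVBelow m t′
FVBelow-↠ ε       fv = fv
FVBelow-↠ (r ◅ q) fv = FVBelow-↠ q (FVBelow-⟶ r fv)

ProofTerm-ren : ∀ {S} ρ → ProofTerm S t → ProofTerm S (ren ρ t)
ProofTerm-ren ρ var        = var
ProofTerm-ren ρ (con X∈S)  = con X∈S
ProofTerm-ren ρ (lam p)    = lam (ProofTerm-ren (ext ρ) p)
ProofTerm-ren ρ (app p q)  = app (ProofTerm-ren ρ p) (ProofTerm-ren ρ q)
ProofTerm-ren ρ (tlam p)   = tlam (ProofTerm-ren ρ p)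
ProofTerm-ren ρ (tapp p)   = tapp (ProofTerm-ren ρ p)

ProofTerm-renTy : ∀ {S S′} → (∀ X → S X → S′ (f X)) →
  ProofTerm S t → ProofTerm S′ (renTy f t)
ProofTerm-renTy f∈ var       = var
ProofTerm-renTy f∈ (con X∈S) = con (f∈ _ X∈S)
ProofTerm-renTy f∈ (lam p)   = lam (ProofTerm-renTy f∈ p)
ProofTerm-renTy f∈ (app p q) = app (ProofTerm-renTy f∈ p) (ProofTerm-renTy f∈ q)
ProofTerm-renTy f∈ (tlam p)  = tlam (ProofTerm-renTy ext∈ p)
  where
  ext∈ : ∀ X → liftS _ X → liftS _ (ext _ X)
  ext∈ (suc X) X∈S = f∈ X X∈S
ProofTerm-renTy f∈ (tapp p)  = tapp (ProofTerm-renTy f∈ p)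

ProofTerm-sub : ∀ {S} → (∀ x → ProofTerm S (σ x)) → ProofTerm S t → ProofTerm S (sub σ t)
ProofTerm-sub σ∈ var       = σ∈ _
ProofTerm-sub σ∈ (con X∈S) = con X∈S
ProofTerm-sub σ∈ (lam p)   = lam (ProofTerm-sub exts∈ p)
  where
  exts∈ : ∀ x → ProofTerm _ (exts _ x)
  exts∈ zero    = var
  exts∈ (suc x) = ProofTerm-ren suc (σ∈ x)
ProofTerm-sub σ∈ (app p q) = app (ProofTerm-sub σ∈ p) (ProofTerm-sub σ∈ q)
ProofTerm-sub σ∈ (tlam p)  = tlam (ProofTerm-sub (ProofTerm-renTy (λ _ X∈S → X∈S) ∘ σ∈) p)
ProofTerm-sub σ∈ (tapp p)  = tapp (ProofTerm-sub σ∈ p)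

ProofTerm-⟶ : ∀ {S} → t ⟶ t′ → ProofTerm S t → ProofTerm S t′
ProofTerm-⟶ β (app (lam p) q) = ProofTerm-sub single∈ p
  where
  single∈ : ∀ x → ProofTerm _ (single _ x)
  single∈ zero    = q
  single∈ (suc x) = var
ProofTerm-⟶ {S = S} (βT {Y = Y}) (tapp (tlam p)) = ProofTerm-renTy inst∈ p
  where
  inst∈ : ∀ X → liftS S X → S (inst Y X)
  inst∈ (suc X) X∈S = X∈S
ProofTerm-⟶ (ξlam r)  (lam p)   = lam (ProofTerm-⟶ r p)
ProofTerm-⟶ (ξappl r) (app p q) = app (ProofTerm-⟶ r p) q
ProofTerm-⟶ (ξappr r) (app p q) = app p (ProofTerm-⟶ r q)
ProofTerm-⟶ (ξtlam r) (tlam p)  = tlam (ProofTerm-⟶ r p)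
ProofTerm-⟶ (ξtapp r) (tapp p)  = tapp (ProofTerm-⟶ r p)

ProofTerm-↠ : ∀ {S} → t ↠ t′ → ProofTerm S t → ProofTerm S t′
ProofTerm-↠ ε       p = p
ProofTerm-↠ (r ◅ q) p = ProofTerm-↠ q (ProofTerm-⟶ r p)

∋-map : ∀ {F : Form → Form} → Θ ∋ x ∶ A → map F Θ ∋ x ∶ F A
∋-map here      = here
∋-map (there p) = there (∋-map p)

∋-map⁻ : ∀ {F : Form → Form} Θ → map F Θ ∋ x ∶ A →
  ∃ λ A₀ → (Θ ∋ x ∶ A₀) × (A ≡ F A₀)
∋-map⁻ (B ∷ Θ) here = B , here , refl
∋-map⁻ (B ∷ Θ) (there p) with ∋-map⁻ Θ p
... | A₀ , q , refl = A₀ , there q , refl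

∋-++ˡ : Γ ∋ x ∶ A → (Γ ++ Θ) ∋ x ∶ A
∋-++ˡ here      = here
∋-++ˡ (there p) = there (∋-++ˡ p)

∋-++ʳ : ∀ Γ → Θ ∋ x ∶ A → (Γ ++ Θ) ∋ length Γ + x ∶ A
∋-++ʳ []      p = p
∋-++ʳ (B ∷ Γ) p = there (∋-++ʳ Γ p)

<length-∋ : ∀ Γ {x} → x < length Γ → ∃ λ A → Γ ∋ x ∶ A
<length-∋ (B ∷ Γ) {zero}  _         = B , here
<length-∋ (B ∷ Γ) {suc x} (s≤s x<n) with <length-∋ Γ x<n
... | A , p = A , there p

renTy-⊢ : ∀ f {Γ} → Γ ⊢ t ∶ A → map (renF f) Γ ⊢ renTy f t ∶ renF f A
renTy-⊢ f (var p)   = var (∋-map p)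
renTy-⊢ f con       = con
renTy-⊢ f (lam d)   = lam (renTy-⊢ f d)
renTy-⊢ f (app d e) = app (renTy-⊢ f d) (renTy-⊢ f e)
renTy-⊢ f {Γ} (tlam d) =
  tlam (subst (_⊢ _ ∶ _) (map-weaken-ext f Γ) (renTy-⊢ (ext f) d))
renTy-⊢ f {Γ} (tapp {A = A} Y d) =
  subst (map (renF f) Γ ⊢ _ ∶_) (sym (renF-[]F f A Y)) (tapp (f Y) (renTy-⊢ f d))

ren-⊢⁻ : ∀ {Γ Δ ρ A} t → (∀ {x B} → Δ ∋ ρ x ∶ B → Γ ∋ x ∶ B) →
  Δ ⊢ ren ρ t ∶ A → Γ ⊢ t ∶ A
ren-⊢⁻ (var x)    ρ⁻ (var p)    = var (ρ⁻ p)
ren-⊢⁻ (con A)    ρ⁻ con        = con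
ren-⊢⁻ (lam t)    ρ⁻ (lam d)    = lam (ren-⊢⁻ t ext⁻ d)
  where
  ext⁻ : ∀ {x C} → (_ ∷ _) ∋ ext _ x ∶ C → (_ ∷ _) ∋ x ∶ C
  ext⁻ {zero}  here      = here
  ext⁻ {suc x} (there p) = there (ρ⁻ p)
ren-⊢⁻ (app t s)  ρ⁻ (app d e)  = app (ren-⊢⁻ t ρ⁻ d) (ren-⊢⁻ s ρ⁻ e)
ren-⊢⁻ {Γ} {Δ} {ρ} (tlam t) ρ⁻ (tlam d) = tlam (ren-⊢⁻ t map⁻ d)
  where
  map⁻ : ∀ {x C} → map (renF suc) Δ ∋ ρ x ∶ C → map (renF suc) Γ ∋ x ∶ C
  map⁻ p with ∋-map⁻ Δ p
  ... | C₀ , q , refl = ∋-map (ρ⁻ q)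
ren-⊢⁻ (tapp t Y) ρ⁻ (tapp .Y d) = tapp Y (ren-⊢⁻ t ρ⁻ d)

weaken-⊢⁻ : map (renF suc) Γ ⊢ renTy suc t ∶ renF suc A → Γ ⊢ t ∶ A
weaken-⊢⁻ {Γ} {t} {A} d =
  subst₂ (λ Γ t → Γ ⊢ t ∶ A) (map-weaken-inst 0 Γ) (weaken-[]T t 0)
    (subst (_ ⊢ _ ∶_) (renF-inverse (λ _ → refl) A) (renTy-⊢ (inst 0) d))

-- η-expansion and stand-ins

η : Form → Tm → Tm
η (at X)  t = t
η (A ⇒ B) t = lam (η B (app (ren suc t) (var 0)))
η (∀' A)  t = tlam (η A (tapp (renTy suc t) 0))

sub-η : ∀ C σ t → sub σ (η C t) ≡ η C (sub σ t)
sub-η (at X)  σ t = refl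
sub-η (A ⇒ B) σ t =
  cong lam (trans (sub-η B (exts σ) (app (ren suc t) (var 0)))
                  (cong (λ t → η B (app t (var 0))) (sub-exts-weaken σ t)))
sub-η (∀' A)  σ t =
  cong tlam (trans (sub-η A (renTy suc ∘ σ) (tapp (renTy suc t) 0))
                   (cong (λ t → η A (tapp t 0)) (sub-tlam-weaken σ t)))

renTy-η : ∀ C f t → renTy f (η C t) ≡ η (renF f C) (renTy f t)
renTy-η (at X)  f t = refl
renTy-η (A ⇒ B) f t =
  cong lam (trans (renTy-η B f (app (ren suc t) (var 0)))
                  (cong (λ t → η (renF f B) (app t (var 0))) (sym (ren-renTy suc f t))))
renTy-η (∀' A)  f t =
  cong tlam (trans (renTy-η A (ext f) (tapp (renTy suc t) 0))
                   (cong (λ t → η (renF (ext f) A) (tapp t 0)) (renTy-square (λ _ → refl) t)))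

η-app-[] : ∀ C t s → η C (app (ren suc t) (var 0)) [ s ] ≡ η C (app t s)
η-app-[] C t s =
  trans (sub-η C (single s) (app (ren suc t) (var 0)))
        (cong (λ t → η C (app t s)) (weaken-[] t s))

η-tapp-[]T : ∀ A t Y → η A (tapp (renTy suc t) 0) [ Y ]T ≡ η (A [ Y ]F) (tapp t Y)
η-tapp-[]T A t Y =
  trans (renTy-η A (inst Y) (tapp (renTy suc t) 0))
        (cong (λ t → η (A [ Y ]F) (tapp t Y)) (weaken-[]T t Y))

FVBelow-η : ∀ {m} C → FVBelow m t → FVBelow m (η C t)
FVBelow-η (at X)  fv = fv
FVBelow-η (A ⇒ B) fv = lam (FVBelow-η B (app (FVBelow-weaken fv) (var (s≤s z≤n))))
FVBelow-η (∀' A)  fv = tlam (FVBelow-η A (tapp (FVBelow-renTy suc fv)))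

standIn : Form → Tm
standIn B = η B (con B)

standIns : List Form → ℕ → Tm
standIns []      = var
standIns (B ∷ Γ) zero    = standIn B
standIns (B ∷ Γ) (suc y) = standIns Γ y

standIns-∋ : Γ ∋ y ∶ B → standIns Γ y ≡ standIn B
standIns-∋ here      = refl
standIns-∋ (there p) = standIns-∋ p

Closed-standIn : ∀ B → Closed (standIn B)
Closed-standIn B = FVBelow-η B con

Closed-standIns : ∀ Γ y → y < length Γ → Closed (standIns Γ y)
Closed-standIns (B ∷ Γ) zero    _        = Closed-standIn B
Closed-standIns (B ∷ Γ) (suc y) (s≤s y<) = Closed-standIns Γ y y<

-- Reducing under stand-ins

data StandInSpine (ℓ : ℕ) (Θ : List Form) : Tm → Set where
  var  : Θ ∋ i ∶ B → y ≡ ℓ + i → StandInSpine ℓ Θ (var y)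
  app  : StandInSpine ℓ Θ a → StandInSpine ℓ Θ (app a s)
  tapp : StandInSpine ℓ Θ a → StandInSpine ℓ Θ (tapp a Y)

StandInSpine-ren : (∀ i → ρ (ℓ + i) ≡ ℓ′ + i) →
  StandInSpine ℓ Θ a → StandInSpine ℓ′ Θ (ren ρ a)
StandInSpine-ren {ρ} ρ+ (var p y≡) = var p (trans (cong ρ y≡) (ρ+ _))
StandInSpine-ren ρ+ (app sp)       = app (StandInSpine-ren ρ+ sp)
StandInSpine-ren ρ+ (tapp sp)      = tapp (StandInSpine-ren ρ+ sp)

StandInSpine-renTy : ∀ f → StandInSpine ℓ Θ a → StandInSpine ℓ (map (renF f) Θ) (renTy f a)
StandInSpine-renTy f (var p y≡) = var (∋-map p) y≡
StandInSpine-renTy f (app sp)   = app (StandInSpine-renTy f sp)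
StandInSpine-renTy f (tapp sp)  = tapp (StandInSpine-renTy f sp)

StandInSpine-sub : (∀ i → σ (ℓ + i) ≡ var (ℓ′ + i)) →
  StandInSpine ℓ Θ a → StandInSpine ℓ′ Θ (sub σ a)
StandInSpine-sub σ+ (var {i = i} p refl) = subst (StandInSpine _ _) (sym (σ+ i)) (var p refl)
StandInSpine-sub σ+ (app sp)             = app (StandInSpine-sub σ+ sp)
StandInSpine-sub σ+ (tapp sp)            = tapp (StandInSpine-sub σ+ sp)

StandInSpine-⟶ : a ⟶ a′ → StandInSpine ℓ Θ a → StandInSpine ℓ Θ a′
StandInSpine-⟶ (ξappl r) (app sp)  = app (StandInSpine-⟶ r sp)
StandInSpine-⟶ (ξappr r) (app sp)  = app sp
StandInSpine-⟶ (ξtapp r) (tapp sp) = tapp (StandInSpine-⟶ r sp)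
StandInSpine-⟶ β         (app ())
StandInSpine-⟶ βT        (tapp ())

StandInSpine-↠ : a ↠ a′ → StandInSpine ℓ Θ a → StandInSpine ℓ Θ a′
StandInSpine-↠ ε       sp = sp
StandInSpine-↠ (r ◅ q) sp = StandInSpine-↠ q (StandInSpine-⟶ r sp)

StandInSpine-app-↠ : StandInSpine ℓ Θ a → app a (var x) ↠ u →
  ∃ λ a′ → (a ↠ a′) × (u ≡ app a′ (var x))
StandInSpine-app-↠ sp ε = _ , ε , refl
StandInSpine-app-↠ sp (ξappl r ◅ q) with StandInSpine-app-↠ (StandInSpine-⟶ r sp) q
... | a′ , q′ , refl = a′ , r ◅ q′ , refl
StandInSpine-app-↠ () (β ◅ q)

StandInSpine-tapp-↠ : StandInSpine ℓ Θ a → tapp a Y ↠ u →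
  ∃ λ a′ → (a ↠ a′) × (u ≡ tapp a′ Y)
StandInSpine-tapp-↠ sp ε = _ , ε , refl
StandInSpine-tapp-↠ sp (ξtapp r ◅ q) with StandInSpine-tapp-↠ (StandInSpine-⟶ r sp) q
... | a′ , q′ , refl = a′ , r ◅ q′ , refl
StandInSpine-tapp-↠ () (βT ◅ q)

StandInSpine-η⇒-↠ : StandInSpine ℓ Θ a → app (ren suc a) (var 0) ↠ u →
  ∃ λ a′ → (a ↠ a′) × (u ≡ app (ren suc a′) (var 0))
StandInSpine-η⇒-↠ {a = a} sp r with StandInSpine-app-↠ (StandInSpine-ren (λ _ → refl) sp) r
... | a″ , q , refl with ren-↠⁻ suc a q
... | a′ , q′ , refl = a′ , q′ , refl

StandInSpine-η∀-↠ : StandInSpine ℓ Θ a → tapp (renTy suc a) 0 ↠ u →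
  ∃ λ a′ → (a ↠ a′) × (u ≡ tapp (renTy suc a′) 0)
StandInSpine-η∀-↠ {a = a} sp r with StandInSpine-tapp-↠ (StandInSpine-renTy suc sp) r
... | a″ , q , refl with renTy-↠⁻ suc a q
... | a′ , q′ , refl = a′ , q′ , refl

-- Abstracts ℓ Θ a b: b is a with every variable ℓ + i, where Θ ∋ i ∶ B, replaced by the
-- stand-in for B, possibly reduced inside its η-expansion; the variables below ℓ are bound
-- by enclosing binders. The η-clauses relate a spine to its partial η-expansions.
data Abstracts : ℕ → List Form → Tm → Tm → Set where
  var   : y < ℓ → Abstracts ℓ Θ (var y) (var y)
  stand : Θ ∋ i ∶ B → y ≡ ℓ + i → Abstracts ℓ Θ (var y) (con B)
  con   : Abstracts ℓ Θ (con A) (con A)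
  lam   : Abstracts (suc ℓ) Θ a b → Abstracts ℓ Θ (lam a) (lam b)
  app   : Abstracts ℓ Θ a b → Abstracts ℓ Θ a′ b′ → Abstracts ℓ Θ (app a a′) (app b b′)
  tlam  : Abstracts ℓ (map (renF suc) Θ) a b → Abstracts ℓ Θ (tlam a) (tlam b)
  tapp  : Abstracts ℓ Θ a b → Abstracts ℓ Θ (tapp a Y) (tapp b Y)
  η⇒    : StandInSpine ℓ Θ a → Abstracts (suc ℓ) Θ (app (ren suc a) (var 0)) c →
          Abstracts ℓ Θ a (lam c)
  η∀    : StandInSpine ℓ Θ a → Abstracts ℓ (map (renF suc) Θ) (tapp (renTy suc a) 0) c →
          Abstracts ℓ Θ a (tlam c)

Abstracts-ren : (∀ y → y < ℓ → ρ y < ℓ′) → (∀ i → ρ (ℓ + i) ≡ ℓ′ + i) →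
  Abstracts ℓ Θ a b → Abstracts ℓ′ Θ (ren ρ a) (ren ρ b)
Abstracts-ren ρ< ρ+ (var y<ℓ)      = var (ρ< _ y<ℓ)
Abstracts-ren {ρ = ρ} ρ< ρ+ (stand p y≡) = stand p (trans (cong ρ y≡) (ρ+ _))
Abstracts-ren ρ< ρ+ con            = con
Abstracts-ren ρ< ρ+ (lam r)        = lam (Abstracts-ren (ext-< ρ<) (cong suc ∘ ρ+) r)
Abstracts-ren ρ< ρ+ (app r r′)     = app (Abstracts-ren ρ< ρ+ r) (Abstracts-ren ρ< ρ+ r′)
Abstracts-ren ρ< ρ+ (tlam r)       = tlam (Abstracts-ren ρ< ρ+ r)
Abstracts-ren ρ< ρ+ (tapp r)       = tapp (Abstracts-ren ρ< ρ+ r)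
Abstracts-ren {ℓ′ = ℓ′} {Θ = Θ} ρ< ρ+ (η⇒ {a = a} sp r) =
  η⇒ (StandInSpine-ren ρ+ sp)
     (subst (λ u → Abstracts (suc ℓ′) Θ (app u (var 0)) _) (ren-square (λ _ → refl) a)
            (Abstracts-ren (ext-< ρ<) (cong suc ∘ ρ+) r))
Abstracts-ren {ρ = ρ} {ℓ′ = ℓ′} {Θ = Θ} ρ< ρ+ (η∀ {a = a} sp r) =
  η∀ (StandInSpine-ren ρ+ sp)
     (subst (λ u → Abstracts ℓ′ (map (renF suc) Θ) (tapp u 0) _) (ren-renTy ρ suc a)
            (Abstracts-ren ρ< ρ+ r))

Abstracts-weaken : Abstracts ℓ Θ a b → Abstracts (suc ℓ) Θ (ren suc a) (ren suc b)
Abstracts-weaken = Abstracts-ren (λ _ → s≤s) (λ _ → refl)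

Abstracts-renTy : ∀ f {ℓ Θ} → Abstracts ℓ Θ a b →
  Abstracts ℓ (map (renF f) Θ) (renTy f a) (renTy f b)
Abstracts-renTy f (var y<ℓ)    = var y<ℓ
Abstracts-renTy f (stand p y≡) = stand (∋-map p) y≡
Abstracts-renTy f con          = con
Abstracts-renTy f (lam r)      = lam (Abstracts-renTy f r)
Abstracts-renTy f (app r r′)   = app (Abstracts-renTy f r) (Abstracts-renTy f r′)
Abstracts-renTy f {ℓ} {Θ} (tlam r) =
  tlam (subst (λ Δ → Abstracts ℓ Δ _ _) (map-weaken-ext f Θ) (Abstracts-renTy (ext f) r))
Abstracts-renTy f (tapp r)     = tapp (Abstracts-renTy f r)
Abstracts-renTy f {ℓ} {Θ} (η⇒ {a = a} sp r) =
  η⇒ (StandInSpine-renTy f sp)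
     (subst (λ u → Abstracts (suc ℓ) (map (renF f) Θ) (app u (var 0)) _) (sym (ren-renTy suc f a))
            (Abstracts-renTy f r))
Abstracts-renTy f {ℓ} {Θ} (η∀ {a = a} sp r) =
  η∀ (StandInSpine-renTy f sp)
     (subst₂ (λ Δ u → Abstracts ℓ Δ (tapp u 0) _)
             (map-weaken-ext f Θ) (renTy-square (λ _ → refl) a)
             (Abstracts-renTy (ext f) r))

Abstracts-exts : (∀ y → y < ℓ → Abstracts ℓ′ Θ (σ y) (τ y)) →
  ∀ y → y < suc ℓ → Abstracts (suc ℓ′) Θ (exts σ y) (exts τ y)
Abstracts-exts σ~τ zero    _         = var (s≤s z≤n)
Abstracts-exts σ~τ (suc y) (s≤s y<ℓ) = Abstracts-weaken (σ~τ y y<ℓ)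

Abstracts-sub : (∀ y → y < ℓ → Abstracts ℓ′ Θ (σ y) (τ y)) →
  (∀ i → σ (ℓ + i) ≡ var (ℓ′ + i)) →
  Abstracts ℓ Θ a b → Abstracts ℓ′ Θ (sub σ a) (sub τ b)
Abstracts-sub σ~τ σ+ (var y<ℓ) = σ~τ _ y<ℓ
Abstracts-sub {ℓ′ = ℓ′} {Θ = Θ} σ~τ σ+ (stand {i = i} p refl) =
  subst (λ u → Abstracts ℓ′ Θ u _) (sym (σ+ i)) (stand p refl)
Abstracts-sub σ~τ σ+ con        = con
Abstracts-sub σ~τ σ+ (lam r)    =
  lam (Abstracts-sub (Abstracts-exts σ~τ) (cong (ren suc) ∘ σ+) r)
Abstracts-sub σ~τ σ+ (app r r′) = app (Abstracts-sub σ~τ σ+ r) (Abstracts-sub σ~τ σ+ r′)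
Abstracts-sub σ~τ σ+ (tlam r)   =
  tlam (Abstracts-sub (λ y y<ℓ → Abstracts-renTy suc (σ~τ y y<ℓ)) (cong (renTy suc) ∘ σ+) r)
Abstracts-sub σ~τ σ+ (tapp r)   = tapp (Abstracts-sub σ~τ σ+ r)
Abstracts-sub {ℓ′ = ℓ′} {Θ} {σ} σ~τ σ+ (η⇒ {a = a} sp r) =
  η⇒ (StandInSpine-sub σ+ sp)
     (subst (λ u → Abstracts (suc ℓ′) Θ (app u (var 0)) _) (sub-exts-weaken σ a)
            (Abstracts-sub (Abstracts-exts σ~τ) (cong (ren suc) ∘ σ+) r))
Abstracts-sub {ℓ′ = ℓ′} {Θ} {σ} σ~τ σ+ (η∀ {a = a} sp r) =
  η∀ (StandInSpine-sub σ+ sp)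
     (subst (λ u → Abstracts ℓ′ (map (renF suc) Θ) (tapp u 0) _) (sub-tlam-weaken σ a)
            (Abstracts-sub (λ y y<ℓ → Abstracts-renTy suc (σ~τ y y<ℓ)) (cong (renTy suc) ∘ σ+) r))

Abstracts-[] : Abstracts (suc ℓ) Θ a b → Abstracts ℓ Θ a′ b′ →
  Abstracts ℓ Θ (a [ a′ ]) (b [ b′ ])
Abstracts-[] r r′ = Abstracts-sub single~ (λ _ → refl) r
  where
  single~ : ∀ y → y < suc _ → Abstracts _ _ (single _ y) (single _ y)
  single~ zero    _         = r′
  single~ (suc y) (s≤s y<ℓ) = var y<ℓ

Abstracts-[]T : ∀ Y → Abstracts ℓ (map (renF suc) Θ) a b → Abstracts ℓ Θ (a [ Y ]T) (b [ Y ]T)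
Abstracts-[]T {ℓ} {Θ} Y r =
  subst (λ Δ → Abstracts ℓ Δ _ _) (map-weaken-inst Y Θ) (Abstracts-renTy (inst Y) r)

Abstracts-η : ∀ C → StandInSpine ℓ Θ a → Abstracts ℓ Θ a b → Abstracts ℓ Θ a (η C b)
Abstracts-η (at X)  sp r = r
Abstracts-η (A ⇒ B) sp r =
  η⇒ sp (Abstracts-η B (app (StandInSpine-ren (λ _ → refl) sp))
                       (app (Abstracts-weaken r) (var (s≤s z≤n))))
Abstracts-η (∀' A)  sp r =
  η∀ sp (Abstracts-η A (tapp (StandInSpine-renTy suc sp)) (tapp (Abstracts-renTy suc r)))

Abstracts-standIn : Θ ∋ i ∶ B → Abstracts ℓ Θ (var (ℓ + i)) (standIn B)
Abstracts-standIn {B = B} p = Abstracts-η B (var p refl) (stand p refl)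

Abstracts-of-sub : FVBelow (ℓ + length Θ) t →
  (∀ y → y < ℓ + length Θ → Abstracts ℓ Θ (var y) (σ y)) →
  Abstracts ℓ Θ t (sub σ t)
Abstracts-of-sub (var y<) σ~ = σ~ _ y<
Abstracts-of-sub con      σ~ = con
Abstracts-of-sub {ℓ} {Θ} {σ = σ} (lam fv) σ~ = lam (Abstracts-of-sub fv exts~)
  where
  exts~ : ∀ y → y < suc ℓ + length Θ → Abstracts (suc ℓ) Θ (var y) (exts σ y)
  exts~ zero    _        = var (s≤s z≤n)
  exts~ (suc y) (s≤s y<) = Abstracts-weaken (σ~ y y<)
Abstracts-of-sub (app fv fv′) σ~ = app (Abstracts-of-sub fv σ~) (Abstracts-of-sub fv′ σ~)
Abstracts-of-sub {ℓ} {Θ} {σ = σ} (tlam fv) σ~ =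
  tlam (Abstracts-of-sub (subst (λ k → FVBelow (ℓ + k) _) (sym (length-map (renF suc) Θ)) fv) σ~′)
  where
  σ~′ : ∀ y → y < ℓ + length (map (renF suc) Θ) →
        Abstracts ℓ (map (renF suc) Θ) (var y) (renTy suc (σ y))
  σ~′ y y< = Abstracts-renTy suc (σ~ y (subst (λ k → y < ℓ + k) (length-map (renF suc) Θ) y<))
Abstracts-of-sub (tapp fv) σ~ = tapp (Abstracts-of-sub fv σ~)

simulate-⟶ : Abstracts ℓ Θ a b → b ⟶ b′ → ∃ λ a′ → (a ↠ a′) × Abstracts ℓ Θ a′ b′
simulate-⟶ (app (lam r) r′) β = _ , β ◅ ε , Abstracts-[] r r′
-- contracting an η-expansion of a spine needs no step of the abstract term
simulate-⟶ {ℓ} {Θ} (app (η⇒ {a = a} sp r) r′) β =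
  _ , ε , subst (λ u → Abstracts ℓ Θ (app u _) _) (weaken-[] a _) (Abstracts-[] r r′)
simulate-⟶ (tapp {Y = Y} (tlam r)) βT = _ , βT ◅ ε , Abstracts-[]T Y r
simulate-⟶ {ℓ} {Θ} (tapp {Y = Y} (η∀ {a = a} sp r)) βT =
  _ , ε , subst (λ u → Abstracts ℓ Θ (tapp u Y) _) (weaken-[]T a Y) (Abstracts-[]T Y r)
simulate-⟶ (lam r) (ξlam s) with simulate-⟶ r s
... | a′ , q , r″ = lam a′ , lam-↠ q , lam r″
simulate-⟶ (app r r′) (ξappl s) with simulate-⟶ r s
... | a′ , q , r″ = _ , appˡ-↠ q , app r″ r′
simulate-⟶ (app r r′) (ξappr s) with simulate-⟶ r′ s
... | a′ , q , r″ = _ , appʳ-↠ q , app r r″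
simulate-⟶ (tlam r) (ξtlam s) with simulate-⟶ r s
... | a′ , q , r″ = tlam a′ , tlam-↠ q , tlam r″
simulate-⟶ (tapp r) (ξtapp s) with simulate-⟶ r s
... | a′ , q , r″ = _ , tapp-↠ q , tapp r″
simulate-⟶ (η⇒ sp r) (ξlam s) with simulate-⟶ r s
... | _ , q , r″ with StandInSpine-η⇒-↠ sp q
... | a′ , q′ , refl = a′ , q′ , η⇒ (StandInSpine-↠ q′ sp) r″
simulate-⟶ (η∀ sp r) (ξtlam s) with simulate-⟶ r s
... | _ , q , r″ with StandInSpine-η∀-↠ sp q
... | a′ , q′ , refl = a′ , q′ , η∀ (StandInSpine-↠ q′ sp) r″

simulate-↠ : Abstracts ℓ Θ a b → b ↠ b′ → ∃ λ a′ → (a ↠ a′) × Abstracts ℓ Θ a′ b′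
simulate-↠ r ε = _ , ε , r
simulate-↠ r (s ◅ s*) with simulate-⟶ r s
... | _ , q , r′ with simulate-↠ r′ s*
... | a′ , q* , r″ = a′ , q ◅◅ q* , r″

Abstracts-HasRedex : Abstracts ℓ Θ a b → HasRedex a → HasRedex b
Abstracts-HasRedex (lam r)          (inlam h)  = inlam (Abstracts-HasRedex r h)
Abstracts-HasRedex (app (lam r) r′) rβ         = rβ
Abstracts-HasRedex (app r r′)       (inappl h) = inappl (Abstracts-HasRedex r h)
Abstracts-HasRedex (app r r′)       (inappr h) = inappr (Abstracts-HasRedex r′ h)
Abstracts-HasRedex (tlam r)         (intlam h) = intlam (Abstracts-HasRedex r h)
Abstracts-HasRedex (tapp (tlam r))  rβT        = rβT
Abstracts-HasRedex (tapp r)         (intapp h) = intapp (Abstracts-HasRedex r h)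
Abstracts-HasRedex (η⇒ sp r)        h          =
  inlam (Abstracts-HasRedex r (inappl (ren-HasRedex suc h)))
Abstracts-HasRedex (η∀ sp r)        h          =
  intlam (Abstracts-HasRedex r (intapp (renTy-HasRedex suc h)))
Abstracts-HasRedex (app (η⇒ () r) r′) rβ
Abstracts-HasRedex (tapp (η∀ () r))   rβT

StandInSpine-weaken-⊢⁻ : StandInSpine ℓ Θ a → map (renF suc) Δ ⊢ renTy suc a ∶ A →
  ∃ λ A₀ → (Δ ⊢ a ∶ A₀) × (A ≡ renF suc A₀)
StandInSpine-weaken-⊢⁻ {Δ = Δ} (var _ _) (var p) with ∋-map⁻ Δ p
... | A₀ , p₀ , refl = A₀ , var p₀ , refl
StandInSpine-weaken-⊢⁻ (app sp) (app d e) with StandInSpine-weaken-⊢⁻ sp d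
... | B₀ ⇒ A₀ , d₀ , refl = A₀ , app d₀ (weaken-⊢⁻ e) , refl
... | at X    , _  , ()
... | ∀' E₀   , _  , ()
StandInSpine-weaken-⊢⁻ (tapp {Y = Y} sp) (tapp _ d) with StandInSpine-weaken-⊢⁻ sp d
... | ∀' E₀   , d₀ , refl = E₀ [ Y ]F , tapp Y d₀ , sym (renF-[]F suc E₀ Y)
... | at X    , _  , ()
... | B₀ ⇒ A₀ , _  , ()

η⇒-⊢⁻ : ∀ a → (A ∷ Δ) ⊢ app (ren suc a) (var 0) ∶ B → Δ ⊢ a ∶ A ⇒ B
η⇒-⊢⁻ a (app d (var here)) = ren-⊢⁻ a (λ { (there p) → p }) d

StandInSpine-η∀-⊢⁻ : StandInSpine ℓ Θ a →
  map (renF suc) Δ ⊢ tapp (renTy suc a) 0 ∶ C → Δ ⊢ a ∶ ∀' C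
StandInSpine-η∀-⊢⁻ sp (tapp 0 d) with StandInSpine-weaken-⊢⁻ sp d
... | ∀' E₀   , d₀ , refl = subst (λ E → _ ⊢ _ ∶ ∀' E) (sym (renF-inverse inst-0-ext-suc E₀)) d₀
  where
  inst-0-ext-suc : inst 0 ∘ ext suc ≗ id
  inst-0-ext-suc zero    = refl
  inst-0-ext-suc (suc x) = refl
... | at X    , _  , ()
... | B₀ ⇒ A₀ , _  , ()

Abstracts-⊢ : Abstracts ℓ Θ a b → ℓ ≡ length Γ → Γ ⊢ b ∶ A → (Γ ++ Θ) ⊢ a ∶ A
Abstracts-weaken-⊢ : Abstracts ℓ (map (renF suc) Θ) a b → ℓ ≡ length Γ →
  map (renF suc) Γ ⊢ b ∶ A → map (renF suc) (Γ ++ Θ) ⊢ a ∶ A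

Abstracts-⊢ (var _)             _    (var p)    = var (∋-++ˡ p)
Abstracts-⊢ {Γ = Γ} (stand p refl) refl con    = var (∋-++ʳ Γ p)
Abstracts-⊢ con                 _    con        = con
Abstracts-⊢ (lam r)             ℓ≡   (lam d)    = lam (Abstracts-⊢ r (cong suc ℓ≡) d)
Abstracts-⊢ (app r r′)          ℓ≡   (app d e)  = app (Abstracts-⊢ r ℓ≡ d) (Abstracts-⊢ r′ ℓ≡ e)
Abstracts-⊢ (tlam r)            ℓ≡   (tlam d)   = tlam (Abstracts-weaken-⊢ r ℓ≡ d)
Abstracts-⊢ (tapp r)            ℓ≡   (tapp Y d) = tapp Y (Abstracts-⊢ r ℓ≡ d)
Abstracts-⊢ (η⇒ {a = a} sp r)   ℓ≡   (lam d)    = η⇒-⊢⁻ a (Abstracts-⊢ r (cong suc ℓ≡) d)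
Abstracts-⊢ (η∀ sp r)           ℓ≡   (tlam d)   =
  StandInSpine-η∀-⊢⁻ sp (Abstracts-weaken-⊢ r ℓ≡ d)

Abstracts-weaken-⊢ {Θ = Θ} {Γ = Γ} r ℓ≡ d =
  subst (_⊢ _ ∶ _) (sym (map-++ (renF suc) Γ Θ))
        (Abstracts-⊢ r (trans ℓ≡ (sym (length-map (renF suc) Γ))) d)

HasNormalForm : List Form → Form → Tm → Set
HasNormalForm Γ A t = ∃ λ s → (t ↠ s) × Normal s × (Γ ⊢ s ∶ A)

↠-HasNormalForm : t ↠ t′ → HasNormalForm Γ A t′ → HasNormalForm Γ A t
↠-HasNormalForm r (s , r′ , normal , typed) = s , r ◅◅ r′ , normal , typed

readBack : FVBelow (length Θ) t → (∀ {y B} → Θ ∋ y ∶ B → σ y ≡ standIn B) →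
  HasNormalForm [] A (sub σ t) → HasNormalForm Θ A t
readBack {Θ} {σ = σ} fv σ≡ (s , r , normal , typed) =
  let a , q , abs = simulate-↠ (Abstracts-of-sub fv standIns~) r
  in a , q , normal ∘ Abstracts-HasRedex abs , Abstracts-⊢ abs refl typed
  where
  standIns~ : ∀ y → y < length Θ → Abstracts 0 Θ (var y) (σ y)
  standIns~ y y< with <length-∋ Θ y<
  ... | B , p = subst (Abstracts 0 Θ (var y)) (sym (σ≡ p)) (Abstracts-standIn p)

lam-HasNormalForm : FVBelow 1 u → HasNormalForm [] C (u [ standIn B ]) → HasNormalForm [] (B ⇒ C) (lam u)
lam-HasNormalForm {B = B} fv nf =
  let a , q , normal , typed = readBack {Θ = B ∷ []} fv (λ { here → refl }) nf
  in lam a , lam-↠ q , (λ { (inlam h) → normal h }) , lam typed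

-- Strict upper bounds on the free atoms: every k ≥ fresh t is fresh for t.
freshF : Form → ℕ
freshF (at X)  = suc X
freshF (A ⇒ B) = freshF A ⊔ freshF B
freshF (∀' A)  = pred (freshF A)

fresh : Tm → ℕ
fresh (var x)    = 0
fresh (con A)    = freshF A
fresh (lam t)    = fresh t
fresh (app t s)  = fresh t ⊔ fresh s
fresh (tlam t)   = pred (fresh t)
fresh (tapp t Y) = fresh t ⊔ suc Y

ext-id-below : ∀ n → (∀ j → j < pred n → f j ≡ j) → ∀ j → j < n → ext f j ≡ j
ext-id-below n f≡ zero    _  = refl
ext-id-below (suc n) f≡ (suc j) (s≤s j<) = cong suc (f≡ j j<)

renF-id-below-fresh : ∀ A → (∀ j → j < freshF A → f j ≡ j) → renF f A ≡ A
renF-id-below-fresh (at X)  f≡ = cong at (f≡ X ≤-refl)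
renF-id-below-fresh (A ⇒ B) f≡ =
  cong₂ _⇒_ (renF-id-below-fresh A (λ j j< → f≡ j (≤-trans j< (m≤m⊔n _ _))))
            (renF-id-below-fresh B (λ j j< → f≡ j (≤-trans j< (m≤n⊔m _ _))))
renF-id-below-fresh (∀' A)  f≡ = cong ∀' (renF-id-below-fresh A (ext-id-below (freshF A) f≡))

renTy-id-below-fresh : ∀ t → (∀ j → j < fresh t → f j ≡ j) → renTy f t ≡ t
renTy-id-below-fresh (var x)    f≡ = refl
renTy-id-below-fresh (con A)    f≡ = cong con (renF-id-below-fresh A f≡)
renTy-id-below-fresh (lam t)    f≡ = cong lam (renTy-id-below-fresh t f≡)
renTy-id-below-fresh (app t s)  f≡ =
  cong₂ app (renTy-id-below-fresh t (λ j j< → f≡ j (≤-trans j< (m≤m⊔n _ _))))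
            (renTy-id-below-fresh s (λ j j< → f≡ j (≤-trans j< (m≤n⊔m _ _))))
renTy-id-below-fresh (tlam t)   f≡ = cong tlam (renTy-id-below-fresh t (ext-id-below (fresh t) f≡))
renTy-id-below-fresh (tapp t Y) f≡ =
  cong₂ tapp (renTy-id-below-fresh t (λ j j< → f≡ j (≤-trans j< (m≤m⊔n _ _))))
             (f≡ Y (m≤n⊔m (fresh t) (suc Y)))

abstractAtom : ℕ → ℕ → ℕ
abstractAtom k j with j ≟ k
... | yes _ = 0
... | no  _ = suc j

abstractAtom-inst : ∀ k j → j < suc k → abstractAtom k (inst k j) ≡ j
abstractAtom-inst k zero _ with k ≟ k
... | yes _  = refl
... | no k≢k = ⊥-elim (k≢k refl)
abstractAtom-inst k (suc j) (s≤s j<k) with j ≟ k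
... | yes j≡k = ⊥-elim (<⇒≢ j<k j≡k)
... | no  _   = refl

tlam-HasNormalForm : ∀ {k} → fresh u ≤ k → freshF A ≤ k →
  HasNormalForm [] (A [ k ]F) (u [ k ]T) → HasNormalForm [] (∀' A) (tlam u)
tlam-HasNormalForm {u} {A} {k} u≤k A≤k (s , r , normal , typed) =
  tlam (renTy (abstractAtom k) s) ,
  tlam-↠ (subst (_↠ _) u≡ (renTy-↠ (abstractAtom k) r)) ,
  (λ { (intlam h) → normal (renTy-HasRedex⁻ (abstractAtom k) s h) }) ,
  tlam (subst ([] ⊢ _ ∶_) A≡ (renTy-⊢ (abstractAtom k) typed))
  where
  u≡ : renTy (abstractAtom k) (u [ k ]T) ≡ u
  u≡ = trans (renTy-∘ (λ _ → refl) u)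
             (renTy-id-below-fresh u (λ j j< → abstractAtom-inst k j (≤-trans j< (m≤n⇒m≤1+n u≤k))))
  A≡ : renF (abstractAtom k) (A [ k ]F) ≡ A
  A≡ = trans (renF-∘ (λ _ → refl) A)
             (renF-id-below-fresh A (λ j j< → abstractAtom-inst k j (≤-trans j< (m≤n⇒m≤1+n A≤k))))

-- Normalisation of qI-valid terms

data NotAbstraction : Tm → Set where
  var  : NotAbstraction (var x)
  con  : NotAbstraction (con A)
  app  : NotAbstraction (app t s)
  tapp : NotAbstraction (tapp t Y)

HasNeutralNormalForm : Form → Tm → Set
HasNeutralNormalForm A t = ∃ λ s → (t ↠ s) × NotAbstraction s × Normal s × ([] ⊢ s ∶ A)

con-HasNeutralNormalForm : ∀ A → HasNeutralNormalForm A (con A)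
con-HasNeutralNormalForm A = con A , ε , con , (λ ()) , con

app-HasNeutralNormalForm : HasNeutralNormalForm (B ⇒ C) t → HasNormalForm [] B s →
  HasNeutralNormalForm C (app t s)
app-HasNeutralNormalForm (t′ , r , notAbs , normal , typed) (s′ , r′ , normal′ , typed′) =
  app t′ s′ , app-↠ r r′ , app , normal-app notAbs , app typed typed′
  where
  normal-app : NotAbstraction t′ → Normal (app t′ s′)
  normal-app ()  rβ
  normal-app _   (inappl h) = normal h
  normal-app _   (inappr h) = normal′ h

tapp-HasNeutralNormalForm : ∀ Y → HasNeutralNormalForm (∀' A) t →
  HasNeutralNormalForm (A [ Y ]F) (tapp t Y)
tapp-HasNeutralNormalForm Y (t′ , r , notAbs , normal , typed) =
  tapp t′ Y , tapp-↠ r , tapp , normal-tapp notAbs , tapp Y typed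
  where
  normal-tapp : NotAbstraction t′ → Normal (tapp t′ Y)
  normal-tapp () rβT
  normal-tapp _  (intapp h) = normal h

depth-⇒ˡ : ∀ {n} → depth (B ⇒ C) ≤ suc n → depth B ≤ n
depth-⇒ˡ {B} {C} (s≤s d) = ≤-trans (m≤m⊔n (depth B) (depth C)) d

depth-⇒ʳ : ∀ {n} → depth (B ⇒ C) ≤ suc n → depth C ≤ n
depth-⇒ʳ {B} {C} (s≤s d) = ≤-trans (m≤n⊔m (depth B) (depth C)) d

depth-[]F : ∀ {n} Y → depth (∀' A) ≤ suc n → depth (A [ Y ]F) ≤ n
depth-[]F {A} Y (s≤s d) = subst (_≤ _) (sym (depth-renF (inst Y) A)) d

η-valid : ∀ n A → depth A ≤ n → HasNeutralNormalForm A t → qIV n A (η A t)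
valid-HasNormalForm : ∀ n A → depth A ≤ n → Closed t → qIV n A t → HasNormalForm [] A t

η-valid n (at X) _ (s , r , _ , normal , typed) = s , r , normal , typed
η-valid {t} (suc n) (B ⇒ C) d nf =
  _ , ε , λ s closed valid →
    subst (qIV n C) (sym (η-app-[] C t s))
      (η-valid n C (depth-⇒ʳ d)
        (app-HasNeutralNormalForm nf (valid-HasNormalForm n B (depth-⇒ˡ d) closed valid)))
η-valid {t} (suc n) (∀' A) d nf =
  _ , ε , λ Y →
    subst (qIV n (A [ Y ]F)) (sym (η-tapp-[]T A t Y))
      (η-valid n (A [ Y ]F) (depth-[]F Y d) (tapp-HasNeutralNormalForm Y nf))

valid-HasNormalForm n (at X) _ _ nf = nf
valid-HasNormalForm (suc n) (B ⇒ C) d closed (u , r , valid) with FVBelow-↠ r closed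
... | lam fv =
  ↠-HasNormalForm r (lam-HasNormalForm fv
    (valid-HasNormalForm n C (depth-⇒ʳ d) (FVBelow-[] fv (Closed-standIn B))
      (valid (standIn B) (Closed-standIn B)
        (η-valid n B (depth-⇒ˡ d) (con-HasNeutralNormalForm B)))))
valid-HasNormalForm (suc n) (∀' A) d closed (u , r , valid) with FVBelow-↠ r closed
... | tlam fv =
  let k = fresh u ⊔ freshF A in
  ↠-HasNormalForm r (tlam-HasNormalForm (m≤m⊔n (fresh u) (freshF A)) (m≤n⊔m (fresh u) (freshF A))
    (valid-HasNormalForm n (A [ k ]F) (depth-[]F k d) (FVBelow-renTy (inst k) fv) (valid k)))

standIn-valid : ∀ A → qIValidClosed A (standIn A)
standIn-valid A = η-valid (depth A) A ≤-refl (con-HasNeutralNormalForm A)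

standIns-valid : ∀ Γ (i : Fin (length Γ)) →
  Closed (standIns Γ (toℕ i)) × qIValidClosed (lookup Γ i) (standIns Γ (toℕ i))
standIns-valid (B ∷ Γ) Fin.zero    = Closed-standIn B , standIn-valid B
standIns-valid (B ∷ Γ) (Fin.suc i) = standIns-valid Γ i

mainTheorem8 : (S : AtomicBase) (A : Form) (Γ : List Form) (t : Tm) →
    FVBelow (length Γ) t →
    IValid S Γ t A →
    Σ Tm λ s → (t ↠ s) × Normal s × ProofTerm S s × (Γ ⊢ s ∶ A)
mainTheorem8 S A Γ t fv (proofTerm , valid) =
  let s , r , normal , typed = readBack fv standIns-∋ instanceNormalises
  in s , r , normal , ProofTerm-↠ r proofTerm , typed
  where
  instanceNormalises : HasNormalForm [] A (sub (standIns Γ) t)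
  instanceNormalises =
    valid-HasNormalForm (depth A) A ≤-refl (FVBelow-sub (Closed-standIns Γ) fv)
      (valid (standIns Γ) (standIns-valid Γ))
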